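{- Let $\mathcal{A}=[a_0,a_1,\ldots,a_{k_1-1}]$ be a binary $(n_1,R_1)$-covering sequence of length $k_1$ and let $\mathcal{B}=[b_0,b_1,\ldots,b_{k_2-1}]$ be a binary $(n_2,R_2)$-covering sequence of length $k_2$, where either $n_1=n_2$ or $n_1=n_2+1$, and $\gcd(k_1,k_2)=1$. Define the cyclic sequence $\mathcal{S}=[s_0,s_1,\ldots,s_{2k_1k_2-1}]$ of length $2k_1k_2$ by $s_{2i}=a_{i \bmod k_1}$ and $s_{2i+1}=b_{i \bmod k_2}$ for $0\le i\le k_1k_2-1$. Then $\mathcal{S}$ is an $(n_1+n_2,R_1+R_2)$-covering sequence of length $2k_1k_2$.
   Context: A cyclic binary sequence $[s_0,\ldots,s_{k-1}]$ of length $k$ has as its windows (consecutive $n$-tuples) the words $(s_i,s_{i+1},\ldots,s_{i+n-1})$, $0\le i\le k-1$, with indices taken modulo $k$. It is an $(n,R)$-covering sequence if for every word $x\in\{0,1\}^n$ there is a window $w$ of length $n$ with Hamming distance $d(x,w)\le R$. -}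

module Defs where

open import Data.Nat using (ℕ; zero; suc; _+_; _*_; _≤_; NonZero)
open import Data.Nat.DivMod using (_%_; _/_)
open import Data.Fin using (Fin; toℕ)
open import Data.Bool using (Bool; if_then_else_; _≟_)
open import Data.Product using (Σ; ∃; _×_)
open import Relation.Nullary.Decidable using (does)

at : {k : ℕ} .{{_ : NonZero k}} → (Fin k → Bool) → ℕ → Bool
at {k} s i = s (Data.Fin.fromℕ< (Data.Nat.DivMod.m%n<n i k))

window : {k : ℕ} .{{_ : NonZero k}} → (Fin k → Bool) → (n : ℕ) → Fin k → (Fin n → Bool)
window s n i j = at s (toℕ i + toℕ j)

hamming : (n : ℕ) → (Fin n → Bool) → (Fin n → Bool) → ℕ
hamming zero x y = 0
hamming (suc n) x y =
  (if does (x Data.Fin.zero ≟ y Data.Fin.zero) then 0 else 1)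
  + hamming n (λ j → x (Data.Fin.suc j)) (λ j → y (Data.Fin.suc j))


IsCovering : {k : ℕ} .{{_ : NonZero k}} → (n R : ℕ) → (Fin k → Bool) → Set
IsCovering {k} n R s =
  (x : Fin n → Bool) → Σ (Fin k) (λ i → hamming n x (window s n i) ≤ R)

interleave : {k₁ k₂ : ℕ} .{{_ : NonZero k₁}} .{{_ : NonZero k₂}} →
  (Fin k₁ → Bool) → (Fin k₂ → Bool) → Fin (2 * (k₁ * k₂)) → Bool
interleave a b p =
  if does (toℕ p % 2 Data.Nat.≟ 0) then at a (toℕ p / 2) else at b (toℕ p / 2)

instance
  nonZero-2kk : {k₁ k₂ : ℕ} .{{_ : NonZero k₁}} .{{_ : NonZero k₂}} → NonZero (2 * (k₁ * k₂))
  nonZero-2kk {suc k₁} {suc k₂} = _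

{-# OPTIONS --safe #-}
module Submission where

-- Write x = x₀x₁…x_{n₁+n₂-1} as the interleaving of its even part (length n₁, as
-- n₂ ≤ n₁ ≤ n₂ + 1) and its odd part (length n₂).  Cover the even part by the window of 𝒜
-- at i₁ and the odd part by the window of ℬ at i₂.  As gcd(k₁,k₂) = 1, the Chinese remainder
-- theorem gives i with i ≡ i₁ (mod k₁) and i ≡ i₂ (mod k₂); the window of 𝒮 at 2i
-- interleaves the windows of 𝒜 and ℬ at i, hence those at i₁ and i₂, and the Hamming
-- distance splits accordingly.

open import Data.Bool using (Bool; false; if_then_else_; _≟_)
open import Data.Fin as Fin using (Fin; toℕ; fromℕ<)
open import Data.Fin.Properties using (toℕ-fromℕ<; fromℕ<-cong; fromℕ<-toℕ; toℕ<n)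
open import Data.Nat using (ℕ; zero; suc; _+_; _*_; _<?_; ⌊_/2⌋; ⌈_/2⌉; NonZero; s≤s; z≤n)
open import Data.Nat.Properties
  using ( +-comm; +-assoc; *-comm; *-suc; +-mono-≤; m*n≢0; n≡⌊n+n/2⌋; n≡⌈n+n/2⌉
        ; module ≤-Reasoning)
open import Data.Nat.DivMod
open import Data.Nat.Divisibility using (_∣_; m∣m*n; n∣m*n; ∣m⇒∣m*n)
open import Data.Nat.Coprimality using (Coprime; coprime-Bézout; gcd≡1⇒coprime)
open import Data.Nat.GCD using (gcd; module Bézout)
open import Data.Nat.Tactic.RingSolver using (solve-∀)
open import Data.Product using (∃-syntax; _×_; _,_; proj₁; proj₂)
open import Data.Sum using (_⊎_; inj₁; inj₂)
open import Data.Empty using (⊥-elim)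
open import Function using (_∘_)
open import Relation.Nullary.Decidable using (does; yes; no)
open import Relation.Binary.PropositionalEquality

private
  variable
    A : Set
    k : ℕ

shift : ℕ → (ℕ → A) → ℕ → A
shift i f t = f (i + t)

alternate : (ℕ → A) → (ℕ → A) → ℕ → A
alternate f g zero    = f 0
alternate f g (suc m) = alternate g (f ∘ suc) m

evens odds : (ℕ → A) → ℕ → A
evens h t = h (2 * t)
odds  h t = h (suc (2 * t))

byParity : (ℕ → A) → (ℕ → A) → ℕ → A
byParity f g u = if does (u % 2 Data.Nat.≟ 0) then f (u / 2) else g (u / 2)

alternate-cong : {f f′ g g′ : ℕ → A} → f ≗ f′ → g ≗ g′ → alternate f g ≗ alternate f′ g′
alternate-cong f≗f′ g≗g′ zero    = f≗f′ 0
alternate-cong f≗f′ g≗g′ (suc m) = alternate-cong g≗g′ (f≗f′ ∘ suc) m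

alternate-shift : ∀ i {f g : ℕ → A} m →
  alternate f g (2 * i + m) ≡ alternate (shift i f) (shift i g) m
alternate-shift zero    m = refl
alternate-shift (suc i) {f} {g} m =
  trans (cong (λ v → alternate f g (v + m)) (*-suc 2 i)) (alternate-shift i m)

alternate-evens-odds : (h : ℕ → A) → alternate (evens h) (odds h) ≗ h
alternate-evens-odds h zero          = refl
alternate-evens-odds h (suc zero)    = refl
alternate-evens-odds h (suc (suc m)) =
  trans (alternate-cong (λ t → cong h (*-suc 2 t)) (λ t → cong (h ∘ suc) (*-suc 2 t)) m)
        (alternate-evens-odds (h ∘ suc ∘ suc) m)

alternate-byParity : (f g : ℕ → A) → alternate f g ≗ byParity f g
alternate-byParity f g zero          = refl
alternate-byParity f g (suc zero)    = refl
alternate-byParity f g (suc (suc m)) =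
  trans (alternate-byParity (f ∘ suc) (g ∘ suc) m)
        (cong (λ v → if does (m % 2 Data.Nat.≟ 0) then f v else g v)
              (sym (m/n≡1+[m∸n]/n {suc (suc m)} {2} (s≤s (s≤s z≤n)))))

byParity-cong : {f g : ℕ → A} {u v : ℕ} →
  u % 2 ≡ v % 2 → f (u / 2) ≡ f (v / 2) → g (u / 2) ≡ g (v / 2) → byParity f g u ≡ byParity f g v
byParity-cong {f = f} {g} {u} {v} u≡v f≡ g≡ =
  trans (cong (λ r → if does (r Data.Nat.≟ 0) then f (u / 2) else g (u / 2)) u≡v)
        (cong₂ (λ y z → if does (v % 2 Data.Nat.≟ 0) then y else z) f≡ g≡)

byParity-% : ∀ K .{{_ : NonZero K}} {f g : ℕ → A} →
  (∀ v → f (v % K) ≡ f v) → (∀ v → g (v % K) ≡ g v) →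
  ∀ u → byParity f g ((u % (2 * K)) {{m*n≢0 2 K}}) ≡ byParity f g u
byParity-% K {f} {g} f-periodic g-periodic u =
  byParity-cong {f = f} {g} {(u % (2 * K)) {{m*n≢0 2 K}}} {u}
                (m∣n⇒o%n%m≡o%m 2 (2 * K) u {{_}} {{m*n≢0 2 K}} (m∣m*n K))
                (trans (cong f u%2K/2≡u/2%K) (f-periodic (u / 2)))
                (trans (cong g u%2K/2≡u/2%K) (g-periodic (u / 2)))
  where
  u%2K/2≡u/2%K : (u % (2 * K)) {{m*n≢0 2 K}} / 2 ≡ u / 2 % K
  u%2K/2≡u/2%K =
    trans (cong (_/ 2) (%-congʳ {o = u} {{m*n≢0 2 K}} {{m*n≢0 K 2}} (*-comm 2 K)))
          (m%[n*o]/o≡m/o%n u K 2 {{_}} {{_}} {{m*n≢0 K 2}})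

⌈n₁+n₂/2⌉≡n₁ : ∀ {n₁ n₂} → n₁ ≡ n₂ ⊎ n₁ ≡ suc n₂ → ⌈ n₁ + n₂ /2⌉ ≡ n₁
⌈n₁+n₂/2⌉≡n₁ {n₁}      (inj₁ refl) = sym (n≡⌈n+n/2⌉ n₁)
⌈n₁+n₂/2⌉≡n₁ {n₂ = n₂} (inj₂ refl) = cong suc (sym (n≡⌊n+n/2⌋ n₂))

⌊n₁+n₂/2⌋≡n₂ : ∀ {n₁ n₂} → n₁ ≡ n₂ ⊎ n₁ ≡ suc n₂ → ⌊ n₁ + n₂ /2⌋ ≡ n₂
⌊n₁+n₂/2⌋≡n₂ {n₁}      (inj₁ refl) = sym (n≡⌊n+n/2⌋ n₁)
⌊n₁+n₂/2⌋≡n₂ {n₂ = n₂} (inj₂ refl) = sym (n≡⌈n+n/2⌉ n₂)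

-- If e ≡ 0 (mod m) and e ≡ 1 (mod n), then r₁ + e s solves the system for s ≡ r₂ - r₁ (mod n).
chineseRemainder-byUnit : ∀ {m n} .{{_ : NonZero m}} .{{_ : NonZero n}} y {e} →
  m ∣ e → 1 + y * n ≡ e → ∀ r₁ r₂ → ∃[ i ] (i % m ≡ r₁ % m × i % n ≡ r₂ % n)
chineseRemainder-byUnit {m} {n@(suc n′)} y {e} m∣e 1+yn≡e r₁ r₂ =
  r₁ + e * s , %-remove-+ʳ r₁ (∣m⇒∣m*n s m∣e) , (begin
    (r₁ + e * s) % n                 ≡⟨ cong (λ v → (r₁ + v * s) % n) 1+yn≡e ⟨
    (r₁ + (1 + y * n) * s) % n       ≡⟨ cong (_% n) (regroup r₁ r₂ y n′) ⟩
    (r₂ + (r₁ + y * s) * n) % n      ≡⟨ [m+kn]%n≡m%n r₂ (r₁ + y * s) n ⟩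
    r₂ % n                           ∎)
  where
  open ≡-Reasoning
  s = r₂ + r₁ * n′
  regroup : ∀ r₁ r₂ y n′ →
    r₁ + (1 + y * suc n′) * (r₂ + r₁ * n′) ≡ r₂ + (r₁ + y * (r₂ + r₁ * n′)) * suc n′
  regroup = solve-∀

chineseRemainder : ∀ {m n} .{{_ : NonZero m}} .{{_ : NonZero n}} → Coprime m n →
  ∀ r₁ r₂ → ∃[ i ] (i % m ≡ r₁ % m × i % n ≡ r₂ % n)
chineseRemainder coprime r₁ r₂ with coprime-Bézout coprime
... | Bézout.+- x y eq = chineseRemainder-byUnit y (n∣m*n x) eq r₁ r₂
... | Bézout.-+ x y eq with chineseRemainder-byUnit x (n∣m*n y) eq r₂ r₁
...   | i , i≡r₂ , i≡r₁ = i , i≡r₁ , i≡r₂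

-- Imported only now: with the instance NonZero (2 * (k₁ * k₂)) of Defs in scope,
-- instance search for NonZero 2 (needed by _ % 2 above) does not terminate.
open import Defs

-- Any value works beyond position n: only the first n entries are ever read.
toStream : {n : ℕ} → (Fin n → Bool) → ℕ → Bool
toStream {n} x m with m <? n
... | yes m<n = x (fromℕ< m<n)
... | no _    = false

toStream-toℕ : {n : ℕ} (x : Fin n → Bool) (j : Fin n) → toStream x (toℕ j) ≡ x j
toStream-toℕ {n} x j with toℕ j <? n
... | yes j<n = cong x (fromℕ<-toℕ j j<n)
... | no  j≮n = ⊥-elim (j≮n (toℕ<n j))

prefixHamming : ℕ → (ℕ → Bool) → (ℕ → Bool) → ℕ
prefixHamming n f g = hamming n (f ∘ toℕ) (g ∘ toℕ)

hamming-cong : ∀ n {x x′ y y′ : Fin n → Bool} →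
  x ≗ x′ → y ≗ y′ → hamming n x y ≡ hamming n x′ y′
hamming-cong zero    x≗x′ y≗y′ = refl
hamming-cong (suc n) x≗x′ y≗y′ =
  cong₂ _+_ (cong₂ (λ u v → if does (u ≟ v) then 0 else 1) (x≗x′ Fin.zero) (y≗y′ Fin.zero))
            (hamming-cong n (x≗x′ ∘ Fin.suc) (y≗y′ ∘ Fin.suc))

prefixHamming-alternate-halves : ∀ N (f g f′ g′ : ℕ → Bool) →
  prefixHamming N (alternate f g) (alternate f′ g′) ≡
  prefixHamming ⌈ N /2⌉ f f′ + prefixHamming ⌊ N /2⌋ g g′
prefixHamming-alternate-halves zero    f g f′ g′ = refl
prefixHamming-alternate-halves (suc N) f g f′ g′ = begin
  d + prefixHamming N (alternate g (f ∘ suc)) (alternate g′ (f′ ∘ suc))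
    ≡⟨ cong (d +_) (prefixHamming-alternate-halves N g (f ∘ suc) g′ (f′ ∘ suc)) ⟩
  d + (prefixHamming ⌈ N /2⌉ g g′ + h)
    ≡⟨ cong (d +_) (+-comm (prefixHamming ⌈ N /2⌉ g g′) h) ⟩
  d + (h + prefixHamming ⌈ N /2⌉ g g′)
    ≡⟨ +-assoc d h (prefixHamming ⌈ N /2⌉ g g′) ⟨
  d + h + prefixHamming ⌈ N /2⌉ g g′ ∎
  where
  open ≡-Reasoning
  d = if does (f 0 ≟ f′ 0) then 0 else 1
  h = prefixHamming ⌊ N /2⌋ (f ∘ suc) (f′ ∘ suc)

prefixHamming-alternate : ∀ {n₁ n₂} → n₁ ≡ n₂ ⊎ n₁ ≡ suc n₂ → (f g f′ g′ : ℕ → Bool) →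
  prefixHamming (n₁ + n₂) (alternate f g) (alternate f′ g′) ≡
  prefixHamming n₁ f f′ + prefixHamming n₂ g g′
prefixHamming-alternate {n₁} {n₂} n₁≈n₂ f g f′ g′ =
  trans (prefixHamming-alternate-halves (n₁ + n₂) f g f′ g′)
        (cong₂ (λ p q → prefixHamming p f f′ + prefixHamming q g g′)
               (⌈n₁+n₂/2⌉≡n₁ n₁≈n₂) (⌊n₁+n₂/2⌋≡n₂ n₁≈n₂))

at-cong : (s : Fin k → Bool) .{{_ : NonZero k}} {u v : ℕ} → u % k ≡ v % k → at s u ≡ at s v
at-cong {k} s {u} {v} u≡v = cong s (fromℕ<-cong _ _ u≡v (m%n<n u k) (m%n<n v k))

at-%-∣ : (s : Fin k → Bool) .{{_ : NonZero k}} {K : ℕ} .{{_ : NonZero K}} →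
  k ∣ K → ∀ u → at s (u % K) ≡ at s u
at-%-∣ {k} s {K} k∣K u = at-cong s (m∣n⇒o%n%m≡o%m k K u k∣K)

shift-at-cong : (s : Fin k → Bool) .{{_ : NonZero k}} {u v : ℕ} →
  u % k ≡ v % k → shift u (at s) ≗ shift v (at s)
shift-at-cong {k} s {u} {v} u≡v t = at-cong s (begin
  (u + t) % k              ≡⟨ %-distribˡ-+ u t k ⟩
  (u % k + t % k) % k      ≡⟨ cong (λ r → (r + t % k) % k) u≡v ⟩
  (v % k + t % k) % k      ≡⟨ %-distribˡ-+ v t k ⟨
  (v + t) % k              ∎)
  where open ≡-Reasoning

module _ {k₁ k₂ : ℕ} .{{_ : NonZero k₁}} .{{_ : NonZero k₂}}
         (a : Fin k₁ → Bool) (b : Fin k₂ → Bool) where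

  private
    K = k₁ * k₂

  at-interleave : at (interleave a b) ≗ alternate (at a) (at b)
  at-interleave u =
    trans (cong (byParity (at a) (at b)) (toℕ-fromℕ< (m%n<n u (2 * K))))
          (trans (byParity-% K {{m*n≢0 k₁ k₂}} (periodic a (m∣m*n k₂)) (periodic b (n∣m*n k₁)) u)
                 (sym (alternate-byParity (at a) (at b) u)))
    where
    periodic : ∀ {k} .{{_ : NonZero k}} (s : Fin k → Bool) →
      k ∣ K → ∀ v → at s ((v % K) {{m*n≢0 k₁ k₂}}) ≡ at s v
    periodic s k∣K = at-%-∣ s {{_}} {{m*n≢0 k₁ k₂}} k∣K

  shift-interleave : ∀ i →
    shift (toℕ ((2 * i) mod (2 * K))) (at (interleave a b)) ≗ alternate (shift i (at a)) (shift i (at b))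
  shift-interleave i t = begin
    at (interleave a b) (toℕ ((2 * i) mod (2 * K)) + t)
      ≡⟨ shift-at-cong (interleave a b) start≡2i t ⟩
    at (interleave a b) (2 * i + t)                 ≡⟨ at-interleave (2 * i + t) ⟩
    alternate (at a) (at b) (2 * i + t)             ≡⟨ alternate-shift i t ⟩
    alternate (shift i (at a)) (shift i (at b)) t   ∎
    where
    open ≡-Reasoning
    start≡2i : toℕ ((2 * i) mod (2 * K)) % (2 * K) ≡ (2 * i) % (2 * K)
    start≡2i = trans (cong (_% (2 * K)) (toℕ-fromℕ< _)) (m%n%n≡m%n (2 * i) (2 * K))

theorem3 : (n₁ n₂ R₁ R₂ k₁ k₂ : ℕ) .{{_ : NonZero k₁}} .{{_ : NonZero k₂}}
    (a : Fin k₁ → Bool) (b : Fin k₂ → Bool) →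
    IsCovering n₁ R₁ a → IsCovering n₂ R₂ b →
    (n₁ ≡ n₂ ⊎ n₁ ≡ suc n₂) → gcd k₁ k₂ ≡ 1 →
    IsCovering (n₁ + n₂) (R₁ + R₂) (interleave a b)
theorem3 n₁ n₂ R₁ R₂ k₁ k₂ a b cover-a cover-b n₁≈n₂ gcd≡1 x = (2 * i) mod _ , (begin
  hamming (n₁ + n₂) x (window (interleave a b) (n₁ + n₂) ((2 * i) mod _))
    ≡⟨ hamming-cong (n₁ + n₂) x≗ w≗ ⟩
  prefixHamming (n₁ + n₂) (alternate (evens X) (odds X)) (alternate A₁ B₂)
    ≡⟨ prefixHamming-alternate n₁≈n₂ _ _ _ _ ⟩
  hamming n₁ (evens X ∘ toℕ) (window a n₁ i₁) + hamming n₂ (odds X ∘ toℕ) (window b n₂ i₂)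
    ≤⟨ +-mono-≤ (proj₂ (cover-a (evens X ∘ toℕ))) (proj₂ (cover-b (odds X ∘ toℕ))) ⟩
  R₁ + R₂ ∎)
  where
  open ≤-Reasoning
  X = toStream x
  i₁ = proj₁ (cover-a (evens X ∘ toℕ))
  i₂ = proj₁ (cover-b (odds X ∘ toℕ))
  crt = chineseRemainder (gcd≡1⇒coprime gcd≡1) (toℕ i₁) (toℕ i₂)
  i = proj₁ crt
  A₁ = shift (toℕ i₁) (at a)
  B₂ = shift (toℕ i₂) (at b)
  x≗ : x ≗ alternate (evens X) (odds X) ∘ toℕ
  x≗ j = sym (trans (alternate-evens-odds X (toℕ j)) (toStream-toℕ x j))
  w≗ : window (interleave a b) (n₁ + n₂) ((2 * i) mod _) ≗ alternate A₁ B₂ ∘ toℕ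
  w≗ j = trans (shift-interleave a b i (toℕ j))
               (alternate-cong (shift-at-cong a (proj₁ (proj₂ crt))) (shift-at-cong b (proj₂ (proj₂ crt))) (toℕ j))
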